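{- For all integers $n\ge 0$ and all integers $k\ge j\ge 0$, \[ a_{3(k-j)+3,\;3k+6}(3n+1)\equiv a_{3(k-j)+3,\;3k+6}(3n+2)\equiv 0 \pmod 3. \]
   Context: For positive integers $r,s$, $a_{r,s}(n)$ denotes the number of multicolored partitions of $n$ in which each even part may appear in one of $r$ colors and each odd part may appear in one of $s$ colors (copies of the same part size in different colors are distinct), with $a_{r,s}(0)=1$. Equivalently, for $|q|<1$, $\sum_{n\ge0}a_{r,s}(n)q^n = f_2^{s-r}/f_1^{s}$, where $f_m=\prod_{i\ge1}(1-q^{mi})$. -}

module Defs where

open import Data.Nat using (ℕ; zero; suc; _+_; _*_; _∸_; _≤?_)
open import Data.Nat.Base using (_%_)
open import Data.Bool using (if_then_else_)
open import Data.List using (List; []; _∷_; _++_; replicate)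
open import Relation.Nullary.Decidable using (does)

isEven : ℕ → Data.Bool.Bool
isEven zero = Data.Bool.true
isEven (suc zero) = Data.Bool.false
isEven (suc (suc m)) = isEven m

sumTo : (ℕ → ℕ) → ℕ → ℕ
sumTo f zero = f zero
sumTo f (suc m) = sumTo f m + f (suc m)

colours : ℕ → ℕ → ℕ → ℕ
colours r s i = if isEven i then r else s

-- list of "coloured part types": one entry (its size) per (size, colour)
-- pair, for sizes 1..m
partTypes : ℕ → ℕ → ℕ → List ℕ
partTypes r s zero = []
partTypes r s (suc m) = partTypes r s m ++ replicate (colours r s (suc m)) (suc m)

-- ways ts n: number of ways to choose a multiplicity for each coloured part
-- type in ts (parts of the same size and colour are indistinguishable)
-- so that the total size is n; i.e. the number of multisets of coloured
-- parts from ts with sum n.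
ways : List ℕ → ℕ → ℕ
ways [] zero = 1
ways [] (suc _) = 0
ways (p ∷ ps) n =
  sumTo (λ k → if does (k * p ≤? n) then ways ps (n ∸ k * p) else 0) n

-- a_{r,s}(n): number of multicoloured partitions of n in which each even
-- part may appear in one of r colours and each odd part in one of s
-- colours (a_{r,s}(0) = 1). Parts have size ≤ n, so types 1..n suffice.
a : ℕ → ℕ → ℕ → ℕ
a r s n = ways (partTypes r s n) n

-- Every part size comes in a multiple of 3 colours, so the generating
-- function is a product of factors 1/(1 − q^p)³ ≡ 1/(1 − q^{3p}) (mod 3),
-- a power series in q³.  Concretely, peeling the colours off one triple at a
-- time, F₀ = F₃/(1 − q^p)³ and F₁ = F₃/(1 − q^p)² satisfy
-- F₀ = F₃ + 3 q^p F₁ + q^{3p} F₀, and strong induction on n shows that the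
-- coefficient of q^n in F₀ is divisible by 3 whenever n is not.
module Submission where

open import Defs
open import Data.Nat using (ℕ; _+_; _*_; _∸_; _≤_)
open import Data.Nat.Divisibility using (_∣_)
open import Data.Product using (_×_)

open import Data.Bool using (true; false; if_then_else_)
open import Data.List using (List; []; _∷_; _++_; replicate)
open import Data.Nat.Base
  using (zero; suc; s≤s; s≤s⁻¹; z<s; s<s; _<_; _≰_; _≤′_; ≤′-refl; ≤′-step; NonZero; >-nonZero⁻¹)
open import Data.Nat.Divisibility
  using (_∤_; divides-refl; _∣0; m∣m*n; ∣-refl; ∣m∣n⇒∣m+n; ∣m+n∣m⇒∣n; ∣m∸n∣n⇒∣m; >⇒∤)
open import Data.Nat.Induction using (<-rec)
open import Data.Nat.Properties
open import Data.Nat.Tactic.RingSolver using (solve-∀)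
open import Data.Product using (_,_)
open import Function using (_∘_)
open import Relation.Nullary using (contradiction; does; yes; no)
open import Relation.Nullary.Decidable using (dec-true; dec-false)
open import Relation.Binary.PropositionalEquality
open ≡-Reasoning

private
  variable
    d m n : ℕ

sumTo-cong : ∀ {f g} → (∀ k → f k ≡ g k) → ∀ n → sumTo f n ≡ sumTo g n
sumTo-cong eq zero    = eq 0
sumTo-cong eq (suc n) = cong₂ _+_ (sumTo-cong eq n) (eq (suc n))

sumTo-suc : ∀ f n → sumTo f (suc n) ≡ f 0 + sumTo (f ∘ suc) n
sumTo-suc f zero    = refl
sumTo-suc f (suc n) = begin
  sumTo f (suc n) + f (suc (suc n))          ≡⟨ cong (_+ f (suc (suc n))) (sumTo-suc f n) ⟩
  f 0 + sumTo (f ∘ suc) n + f (suc (suc n))  ≡⟨ +-assoc (f 0) _ _ ⟩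
  f 0 + sumTo (f ∘ suc) (suc n)              ∎

sumTo-vanishing : ∀ {f} → (∀ k → m < k → f k ≡ 0) → m ≤′ n → sumTo f n ≡ sumTo f m
sumTo-vanishing vanish ≤′-refl = refl
sumTo-vanishing {m} {suc n} {f} vanish (≤′-step m≤′n) = begin
  sumTo f n + f (suc n)  ≡⟨ cong₂ _+_ (sumTo-vanishing vanish m≤′n) (vanish (suc n) (s≤s (≤′⇒≤ m≤′n))) ⟩
  sumTo f m + 0          ≡⟨ +-identityʳ (sumTo f m) ⟩
  sumTo f m              ∎

-- shift m f is the coefficient sequence of q^m F, where F has coefficients f.
shift : ℕ → (ℕ → ℕ) → ℕ → ℕ
shift m f n = if does (m ≤? n) then f (n ∸ m) else 0

shift-≤ : ∀ f → m ≤ n → shift m f n ≡ f (n ∸ m)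
shift-≤ {m} {n} f m≤n rewrite dec-true (m ≤? n) m≤n = refl

shift-≰ : ∀ f → m ≰ n → shift m f n ≡ 0
shift-≰ {m} {n} f m≰n rewrite dec-false (m ≤? n) m≰n = refl

shift-cong : ∀ f g → (m ≤ n → f (n ∸ m) ≡ g (n ∸ m)) → shift m f n ≡ shift m g n
shift-cong {m} {n} f g eq with m ≤? n
... | yes m≤n = trans (shift-≤ f m≤n) (trans (eq m≤n) (sym (shift-≤ g m≤n)))
... | no  m≰n = trans (shift-≰ f m≰n) (sym (shift-≰ g m≰n))

shift-+ : ∀ m {f} g h → (∀ k → f k ≡ g k + h k) →
          ∀ n → shift m f n ≡ shift m g n + shift m h n
shift-+ m {f} g h eq n with m ≤? n
... | yes m≤n = begin
  shift m f n                ≡⟨ shift-≤ f m≤n ⟩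
  f (n ∸ m)                  ≡⟨ eq (n ∸ m) ⟩
  g (n ∸ m) + h (n ∸ m)      ≡⟨ cong₂ _+_ (shift-≤ g m≤n) (shift-≤ h m≤n) ⟨
  shift m g n + shift m h n  ∎
... | no m≰n =
  trans (shift-≰ f m≰n) (sym (cong₂ _+_ (shift-≰ g m≰n) (shift-≰ h m≰n)))

shift-∣ : ∀ f → (m ≤ n → d ∣ f (n ∸ m)) → d ∣ shift m f n
shift-∣ {m} {n} {d} f div with m ≤? n
... | yes m≤n = subst (d ∣_) (sym (shift-≤ f m≤n)) (div m≤n)
... | no  m≰n = subst (d ∣_) (sym (shift-≰ f m≰n)) (d ∣0)

shift-shift : ∀ m k f n → shift m (shift k f) n ≡ shift (k + m) f n
shift-shift m k f n with k + m ≤? n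
... | yes k+m≤n = begin
  shift m (shift k f) n  ≡⟨ shift-≤ (shift k f) (m+n≤o⇒n≤o k k+m≤n) ⟩
  shift k f (n ∸ m)      ≡⟨ shift-≤ f (m+n≤o⇒m≤o∸n k k+m≤n) ⟩
  f (n ∸ m ∸ k)          ≡⟨ cong f (trans (∸-+-assoc n m k) (cong (n ∸_) (+-comm m k))) ⟩
  f (n ∸ (k + m))        ≡⟨ shift-≤ f k+m≤n ⟨
  shift (k + m) f n      ∎
... | no k+m≰n = trans vanishes (sym (shift-≰ f k+m≰n))
  where
  vanishes : shift m (shift k f) n ≡ 0
  vanishes with m ≤? n
  ... | yes m≤n = trans (shift-≤ (shift k f) m≤n) (shift-≰ f (k+m≰n ∘ m≤o∸n⇒m+n≤o k m≤n))
  ... | no  m≰n = shift-≰ (shift k f) m≰n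

shift³ : ∀ p f n → shift p (shift p (shift p f)) n ≡ shift (3 * p) f n
shift³ p f n = begin
  shift p (shift p (shift p f)) n  ≡⟨ shift-shift p p (shift p f) n ⟩
  shift (p + p) (shift p f) n      ≡⟨ shift-shift (p + p) p f n ⟩
  shift (p + (p + p)) f n          ≡⟨ cong (λ m → shift (p + (p + m)) f n) (+-identityʳ p) ⟨
  shift (3 * p) f n                ∎

shift-sumTo : ∀ m (F : ℕ → ℕ → ℕ) j n →
              shift m (λ i → sumTo (λ k → F k i) j) n ≡ sumTo (λ k → shift m (F k) n) j
shift-sumTo m F zero    n = refl
shift-sumTo m F (suc j) n =
  trans (shift-+ m (λ i → sumTo (λ k → F k i) j) (F (suc j)) (λ _ → refl) n)
        (cong (_+ shift m (F (suc j)) n) (shift-sumTo m F j n))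

-- fᵢ are the coefficients of F₃/(1 − x)^{3−i} with x = q^p, and the identity is
-- (1 − x)³ + 3x(1 − x) + x³ = 1, the subtraction-free form of
-- (1 − x)³ ≡ 1 − x³ (mod 3).
shift-cube : ∀ p {f₀ f₁ f₂ f₃ : ℕ → ℕ} →
             (∀ n → f₀ n ≡ f₁ n + shift p f₀ n) →
             (∀ n → f₁ n ≡ f₂ n + shift p f₁ n) →
             (∀ n → f₂ n ≡ f₃ n + shift p f₂ n) →
             ∀ n → f₀ n ≡ f₃ n + 3 * shift p f₁ n + shift (3 * p) f₀ n
shift-cube p {f₀} {f₁} {f₂} {f₃} f₀-rec f₁-rec f₂-rec n = begin
  f₀ n
    ≡⟨ f₀-rec n ⟩
  f₁ n + S f₀ n
    ≡⟨ cong₂ _+_ (trans (f₁-rec n) (cong (_+ S f₁ n) (f₂-rec n)))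
                 (trans (Sf₀-rec n) (cong (S f₁ n +_) (shift-+ p (S f₁) (S (S f₀)) Sf₀-rec n))) ⟩
  (f₃ n + S f₂ n) + S f₁ n + (S f₁ n + (S (S f₁) n + S (S (S f₀)) n))
    ≡⟨ collect (f₃ n) (S f₂ n) (S (S f₁) n) (S (S (S f₀)) n) (shift-+ p f₂ (S f₁) f₁-rec n) ⟩
  f₃ n + 3 * S f₁ n + S (S (S f₀)) n
    ≡⟨ cong (f₃ n + 3 * S f₁ n +_) (shift³ p f₀ n) ⟩
  f₃ n + 3 * S f₁ n + shift (3 * p) f₀ n
    ∎
  where
  S : (ℕ → ℕ) → ℕ → ℕ
  S = shift p

  Sf₀-rec : ∀ k → S f₀ k ≡ S f₁ k + S (S f₀) k
  Sf₀-rec = shift-+ p f₁ (S f₀) f₀-rec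

  regroup : ∀ a x c e → (a + x) + (x + c) + ((x + c) + (c + e)) ≡ a + 3 * (x + c) + e
  regroup = solve-∀

  collect : ∀ a x c e {b} → b ≡ x + c → (a + x) + b + (b + (c + e)) ≡ a + 3 * b + e
  collect a x c e refl = regroup a x c e

ways-∷ : ∀ p .{{_ : NonZero p}} ps n → ways (p ∷ ps) n ≡ ways ps n + shift p (ways (p ∷ ps)) n
ways-∷ p ps zero = begin
  ways (p ∷ ps) 0                  ≡⟨ +-identityʳ (ways ps 0) ⟨
  ways ps 0 + 0                    ≡⟨ cong (ways ps 0 +_) (shift-≰ (ways (p ∷ ps)) (<⇒≱ (>-nonZero⁻¹ p))) ⟨
  ways ps 0 + shift p (ways (p ∷ ps)) 0 ∎
ways-∷ p ps (suc n) = begin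
  ways (p ∷ ps) (suc n)
    ≡⟨ sumTo-suc (term (suc n)) n ⟩
  ways ps (suc n) + sumTo (λ k → shift (p + k * p) (ways ps) (suc n)) n
    ≡⟨ cong (ways ps (suc n) +_) (sumTo-cong split n) ⟩
  ways ps (suc n) + sumTo (λ k → shift p (shift (k * p) (ways ps)) (suc n)) n
    ≡⟨ cong (ways ps (suc n) +_) (shift-sumTo p (λ k i → term i k) n (suc n)) ⟨
  ways ps (suc n) + shift p (λ i → sumTo (term i) n) (suc n)
    ≡⟨ cong (ways ps (suc n) +_) (shift-cong (λ i → sumTo (term i) n) (ways (p ∷ ps)) truncate) ⟩
  ways ps (suc n) + shift p (ways (p ∷ ps)) (suc n)
    ∎
  where
  term : ℕ → ℕ → ℕ
  term i k = shift (k * p) (ways ps) i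

  split : ∀ k → shift (p + k * p) (ways ps) (suc n) ≡ shift p (shift (k * p) (ways ps)) (suc n)
  split k = trans (cong (λ m → shift m (ways ps) (suc n)) (+-comm p (k * p)))
                  (sym (shift-shift p (k * p) (ways ps) (suc n)))

  truncate : p ≤ suc n → sumTo (term (suc n ∸ p)) n ≡ sumTo (term (suc n ∸ p)) (suc n ∸ p)
  truncate p≤1+n = sumTo-vanishing
    (λ k i<k → shift-≰ (ways ps) (<⇒≱ (<-≤-trans i<k (m≤m*n k p))))
    (≤⇒≤′ (s≤s⁻¹ (∸-monoʳ-< (>-nonZero⁻¹ p) p≤1+n)))

data Tripled : List ℕ → Set where
  []   : Tripled []
  _∷³_ : ∀ p {ps} → Tripled ps → Tripled (suc p ∷ suc p ∷ suc p ∷ ps)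

Tripled-++ : ∀ {xs ys} → Tripled xs → Tripled ys → Tripled (xs ++ ys)
Tripled-++ []        ys = ys
Tripled-++ (p ∷³ xs) ys = p ∷³ Tripled-++ xs ys

Tripled-replicate : ∀ {c} p → 3 ∣ c → Tripled (replicate c (suc p))
Tripled-replicate p (divides-refl q) = go q
  where
  go : ∀ q → Tripled (replicate (q * 3) (suc p))
  go zero    = []
  go (suc q) = p ∷³ go q

∣colours : ∀ {r s} → d ∣ r → d ∣ s → ∀ i → d ∣ colours r s i
∣colours d∣r d∣s i with isEven i
... | true  = d∣r
... | false = d∣s

Tripled-partTypes : ∀ {r s} → 3 ∣ r → 3 ∣ s → ∀ N → Tripled (partTypes r s N)
Tripled-partTypes 3∣r 3∣s zero    = []
Tripled-partTypes 3∣r 3∣s (suc N) =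
  Tripled-++ (Tripled-partTypes 3∣r 3∣s N) (Tripled-replicate N (∣colours 3∣r 3∣s (suc N)))

3∣ways : ∀ {ts} → Tripled ts → ∀ n → 3 ∤ n → 3 ∣ ways ts n
3∣ways []       zero    3∤0 = contradiction (3 ∣0) 3∤0
3∣ways []       (suc n) _   = 3 ∣0
3∣ways (_∷³_ p {ps} t) = <-rec (λ n → 3 ∤ n → 3 ∣ g n) step
  where
  q : ℕ
  q = suc p

  g : ℕ → ℕ
  g = ways (q ∷ q ∷ q ∷ ps)

  step : ∀ n → (∀ {m} → m < n → 3 ∤ m → 3 ∣ g m) → 3 ∤ n → 3 ∣ g n
  step n ih 3∤n = subst (3 ∣_) (sym cube)
    (∣m∣n⇒∣m+n (∣m∣n⇒∣m+n (3∣ways t n 3∤n) (m∣m*n (shift q (ways (q ∷ q ∷ ps)) n)))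
                (shift-∣ g earlier))
    where
    cube : g n ≡ ways ps n + 3 * shift q (ways (q ∷ q ∷ ps)) n + shift (3 * q) g n
    cube = shift-cube q (ways-∷ q (q ∷ q ∷ ps)) (ways-∷ q (q ∷ ps)) (ways-∷ q ps) n

    earlier : 3 * q ≤ n → 3 ∣ g (n ∸ 3 * q)
    earlier 3q≤n = ih (∸-monoʳ-< z<s 3q≤n)
                      (λ 3∣n∸3q → 3∤n (∣m∸n∣n⇒∣m 3 3q≤n 3∣n∸3q (m∣m*n q)))

3∣a : ∀ {r s n} → 3 ∣ r → 3 ∣ s → 3 ∤ n → 3 ∣ a r s n
3∣a {n = n} 3∣r 3∣s = 3∣ways (Tripled-partTypes 3∣r 3∣s n) n

m∤m*n+o : ∀ {m o} n → .{{NonZero o}} → o < m → m ∤ m * n + o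
m∤m*n+o n o<m m∣mn+o = >⇒∤ o<m (∣m+n∣m⇒∣n m∣mn+o (m∣m*n n))

theorem1p6 : (n k j : ℕ) → j ≤ k →
    (3 ∣ a (3 * (k ∸ j) + 3) (3 * k + 6) (3 * n + 1))
    × (3 ∣ a (3 * (k ∸ j) + 3) (3 * k + 6) (3 * n + 2))
theorem1p6 n k j _ = 3∣a 3∣r 3∣s (m∤m*n+o n (s<s z<s)) , 3∣a 3∣r 3∣s (m∤m*n+o n (s<s (s<s z<s)))
  where
  3∣r : 3 ∣ 3 * (k ∸ j) + 3
  3∣r = ∣m∣n⇒∣m+n (m∣m*n (k ∸ j)) ∣-refl

  3∣s : 3 ∣ 3 * k + 6
  3∣s = ∣m∣n⇒∣m+n (m∣m*n k) (divides-refl 2)
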